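{- Let $G$ be a partial cube of isometric dimension $h$, let $u$ be a vertex of degree $h$ in $G$, and suppose that $|N^u(v)|\ge 2$ for every $v\in V(G)\setminus N[u]$. Define $\alpha:V(G)\to B^h$ by $\alpha(u)=0^h$, giving the vertices of $N(u)$ pairwise different labels of the form $0^{i-1}10^{h-i}$, $i\in[h]$, and setting $\alpha(v)=\bigvee_{z\in N^u(v)}\alpha(z)$ for every other vertex $v$ (recursively by increasing distance from $u$). Then (i) $\alpha$ is an isometric embedding of $G$ into $Q_h$; (ii) once a fixed embedding of the vertices in $N[u]$ is chosen, $\alpha$ is unique.
   Context: $B=\{0,1\}$, $B^h$ binary words of length $h$, $Q_h$ the hypercube on $B^h$ (adjacent iff Hamming distance $1$), $[h]=\{1,\dots,h\}$, $\vee$ bitwise OR. An isometric embedding of $G$ into $Q_h$ is a map $V(G)\to B^h$ with Hamming distance equal to graph distance. A partial cube is a graph admitting an isometric embedding into some hypercube; its isometric dimension is the least such $h$. $N(u)$ is the neighbourhood of $u$, $N[u]=N(u)\cup\{u\}$, and $N^u(v)=\{z\in N(v): d_G(u,z)=d_G(u,v)-1\}$. -}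

module Defs where

open import Data.Nat using (ℕ; zero; suc; _≤_; _<_)
open import Data.Bool using (Bool; true; false; _∨_)
open import Data.Fin using (Fin; _≟_)
open import Data.Fin.Subset using (∣_∣)
open import Data.Vec using (Vec; []; _∷_; tabulate; lookup; replicate)
open import Data.Product using (Σ; ∃; _×_; _,_)
open import Relation.Nullary using (¬_)
open import Relation.Nullary.Decidable using (isYes)
open import Relation.Binary.PropositionalEquality using (_≡_; _≢_)

record Graph : Set where
  field
    n     : ℕ
    adj   : Fin n → Fin n → Bool
    sym   : ∀ x y → adj x y ≡ adj y x
    irrefl : ∀ x → adj x x ≡ false
open Graph public

Vertex : Graph → Set
Vertex G = Fin (n G)

Adj : (G : Graph) → Vertex G → Vertex G → Set
Adj G x y = adj G x y ≡ true

data Walk (G : Graph) : Vertex G → Vertex G → ℕ → Set where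
  here : ∀ {x} → Walk G x x zero
  step : ∀ {x y z k} → Adj G x y → Walk G y z k → Walk G x z (suc k)

IsDist : (G : Graph) → Vertex G → Vertex G → ℕ → Set
IsDist G x y k = Walk G x y k × (∀ m → Walk G x y m → k ≤ m)

Word : ℕ → Set
Word h = Vec Bool h

hamming : ∀ {h} → Word h → Word h → ℕ
hamming [] [] = zero
hamming (true ∷ a) (false ∷ b) = suc (hamming a b)
hamming (false ∷ a) (true ∷ b) = suc (hamming a b)
hamming (_ ∷ a) (_ ∷ b) = hamming a b

IsIsometricEmbedding : (G : Graph) (h : ℕ) → (Vertex G → Word h) → Set
IsIsometricEmbedding G h f = ∀ x y → IsDist G x y (hamming (f x) (f y))

IsPartialCubeOfDim : Graph → ℕ → Set
IsPartialCubeOfDim G h =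
  (Σ (Vertex G → Word h) (IsIsometricEmbedding G h)) ×
  (∀ k → k < h → ¬ Σ (Vertex G → Word k) (IsIsometricEmbedding G k))

deg : (G : Graph) → Vertex G → ℕ
deg G u = ∣ tabulate (adj G u) ∣

InNu : (G : Graph) → (u v z : Vertex G) → Set
InNu G u v z = Adj G v z × ∃ λ k → IsDist G u v (suc k) × IsDist G u z k

unitWord : ∀ {h} → Fin h → Word h
unitWord i = tabulate (λ j → isYes (i ≟ j))

zeroWord : ∀ h → Word h
zeroWord h = replicate h false

ValidNeighbourLabels : (G : Graph) (h : ℕ) (u : Vertex G) → (Vertex G → Word h) → Set
ValidNeighbourLabels G h u β =
  (∀ v → Adj G u v → ∃ λ (i : Fin h) → β v ≡ unitWord i) ×
  (∀ v w → Adj G u v → Adj G u w → β v ≡ β w → v ≡ w)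

-- α follows the recursive definition with labels β on N(u):
-- α(u) = 0^h, α = β on N(u), and for v ∉ N[u], α(v) is the bitwise OR
-- of α(z) over z ∈ N^u(v) (bit i of the OR is 1 iff some member has bit i = 1).
IsAlpha : (G : Graph) (h : ℕ) (u : Vertex G) → (β α : Vertex G → Word h) → Set
IsAlpha G h u β α =
  (α u ≡ zeroWord h) ×
  (∀ v → Adj G u v → α v ≡ β v) ×
  (∀ v → v ≢ u → adj G u v ≡ false → ∀ (i : Fin h) →
     (lookup (α v) i ≡ true → ∃ λ z → InNu G u v z × lookup (α z) i ≡ true) ×
     (∀ z → InNu G u v z → lookup (α z) i ≡ true → lookup (α v) i ≡ true))

-- Compose an isometric embedding e of G with an automorphism of Q_h sending e(u) to 0^h: since
-- deg u = h and the edges at u flip pairwise different coordinates, every coordinate is flipped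
-- at u exactly once, so a permutation of coordinates can match the coordinate flipped along uv
-- with the position of the 1 in β(v). For an isometric embedding with u ↦ 0^h the weight of a
-- label is the distance to u, so each z ∈ N^u(v) arises from v by clearing a single bit; two
-- distinct such z clear different bits, hence α(v) is the OR of the α(z). Uniqueness follows by
-- induction on the distance to u.

module Submission where

open import Defs hiding (sym)
open import Axiom.UniquenessOfIdentityProofs using (module Decidable⇒UIP)
open import Data.Bool using (Bool; true; false; _xor_; if_then_else_)
import Data.Bool as Bool
open import Data.Bool.Properties using (¬-not; xor-same; xor-inverseˡ; ⇔→≡)
open import Data.Fin using (Fin; zero; suc; _≟_; punchOut)
open import Data.Fin.Permutation using (Permutation; permutation; _⟨$⟩ʳ_; _⟨$⟩ˡ_; inverseˡ)
open import Data.Fin.Subset using (∣_∣)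
open import Data.Fin.Properties using (any?; punchOut-injective; injective⇒≤; suc-injective)
open import Data.Nat using (ℕ; zero; suc; _≤_; z≤n; s≤s)
open import Data.Nat.Properties using (+-0-commutativeMonoid; 1+n≰n; <⇒≢; n≤1+n)
import Data.Nat.Properties as ℕ
open import Data.Product using (Σ; ∃; ∃₂; _×_; _,_; proj₁; proj₂)
open import Data.Vec using (Vec; []; _∷_; tabulate; lookup)
open import Data.Vec.Properties using (lookup∘tabulate; tabulate∘lookup; tabulate-cong; lookup-replicate)
open import Function using (_∘_; mk⇔)
open import Function.Definitions using (Injective)
open import Relation.Nullary using (yes; no; contradiction)
open import Relation.Nullary.Decidable using (isYes)
open import Relation.Binary.PropositionalEquality
open import Algebra.Properties.CommutativeMonoid.Sum +-0-commutativeMonoid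
  using (sum; sum-permute; sum-cong-≗)

-- Injective labellings of a finite support

injective⇒surjective : ∀ {m} (f : Fin m → Fin m) → Injective _≡_ _≡_ f →
                       ∀ i → ∃ λ j → f j ≡ i
injective⇒surjective {suc m} f f-inj i with any? (λ j → f j ≟ i)
... | yes hit  = hit
... | no  miss = contradiction (injective⇒≤ avoid-injective) 1+n≰n
  where
  avoid : Fin (suc m) → Fin m
  avoid j = punchOut (λ i≡fj → miss (j , sym i≡fj))
  avoid-injective : Injective _≡_ _≡_ avoid
  avoid-injective eq = f-inj (punchOut-injective {i = i} _ _ eq)

enumerate : ∀ {m} (p : Fin m → Bool) → Fin ∣ tabulate p ∣ → Fin m
enumerate {suc m} p k with p zero
enumerate {suc m} p zero    | true  = zero
enumerate {suc m} p (suc k) | true  = suc (enumerate (p ∘ suc) k)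
enumerate {suc m} p k       | false = suc (enumerate (p ∘ suc) k)

enumerate-support : ∀ {m} (p : Fin m → Bool) k → p (enumerate p k) ≡ true
enumerate-support {suc m} p k with p zero in p0
enumerate-support {suc m} p zero    | true  = p0
enumerate-support {suc m} p (suc k) | true  = enumerate-support (p ∘ suc) k
enumerate-support {suc m} p k       | false = enumerate-support (p ∘ suc) k

enumerate-injective : ∀ {m} (p : Fin m → Bool) → Injective _≡_ _≡_ (enumerate p)
enumerate-injective {suc m} p eq with p zero
enumerate-injective {suc m} p {zero}  {zero}  eq | true = refl
enumerate-injective {suc m} p {suc k} {suc l} eq | true =
  cong suc (enumerate-injective (p ∘ suc) (suc-injective eq))
enumerate-injective {suc m} p eq | false =
  enumerate-injective (p ∘ suc) (suc-injective eq)

support-irrelevant : ∀ {m} (p : Fin m → Bool) {x} (px px′ : p x ≡ true) → px ≡ px′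
support-irrelevant p = Decidable⇒UIP.≡-irrelevant Bool._≟_

Labelling : ∀ {m} → (Fin m → Bool) → ℕ → Set
Labelling p h = ∀ x → p x ≡ true → Fin h

InjectiveLabelling : ∀ {m h} {p : Fin m → Bool} → Labelling p h → Set
InjectiveLabelling {p = p} f = ∀ {x y} {px : p x ≡ true} {py : p y ≡ true} → f x px ≡ f y py → x ≡ y

injectiveLabelling⇒onto : ∀ {m h} {p : Fin m → Bool} → ∣ tabulate p ∣ ≡ h →
                          (f : Labelling p h) → InjectiveLabelling f → ∀ i → ∃₂ λ x px → f x px ≡ i
injectiveLabelling⇒onto {p = p} refl f f-inj i =
  let k , fk≡i = injective⇒surjective (λ k → f (enumerate p k) (enumerate-support p k))
                                      (enumerate-injective p ∘ f-inj) i
  in enumerate p k , enumerate-support p k , fk≡i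

module _ {m h} {p : Fin m → Bool} (size : ∣ tabulate p ∣ ≡ h) where

  transfer : (f g : Labelling p h) → InjectiveLabelling f → Fin h → Fin h
  transfer f g f-inj i = let x , px , _ = injectiveLabelling⇒onto size f f-inj i in g x px

  transfer-matches : (f g : Labelling p h) (f-inj : InjectiveLabelling f) →
                     ∀ x px → transfer f g f-inj (f x px) ≡ g x px
  transfer-matches f g f-inj x px = respects (proj₂ (proj₂ (injectiveLabelling⇒onto size f f-inj (f x px))))
    where
    respects : ∀ {y py} → f y py ≡ f x px → g y py ≡ g x px
    respects eq with refl ← f-inj eq = cong (g x) (support-irrelevant p _ _)

  transfer-inverse : (f g : Labelling p h) (f-inj : InjectiveLabelling f) (g-inj : InjectiveLabelling g) →
                     ∀ j → transfer f g f-inj (transfer g f g-inj j) ≡ j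
  transfer-inverse f g f-inj g-inj j =
    let y , py , gy≡j = injectiveLabelling⇒onto size g g-inj j
    in trans (transfer-matches f g f-inj y py) gy≡j

  matchingPermutation : (f g : Labelling p h) → InjectiveLabelling f → InjectiveLabelling g →
                        ∃ λ (π : Permutation h h) → ∀ x px → π ⟨$⟩ʳ f x px ≡ g x px
  matchingPermutation f g f-inj g-inj =
    permutation (transfer f g f-inj) (transfer g f g-inj)
                (transfer-inverse f g f-inj g-inj) (transfer-inverse g f g-inj f-inj) ,
    transfer-matches f g f-inj

permutation-injective : ∀ {h} (π : Permutation h h) → Injective _≡_ _≡_ (π ⟨$⟩ʳ_)
permutation-injective π eq = trans (sym (inverseˡ π)) (trans (cong (π ⟨$⟩ˡ_) eq) (inverseˡ π))

lookup-extensionality : ∀ {A : Set} {h} {a b : Vec A h} → (∀ i → lookup a i ≡ lookup b i) → a ≡ b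
lookup-extensionality {a = a} {b} eq =
  trans (sym (tabulate∘lookup a)) (trans (tabulate-cong eq) (tabulate∘lookup b))

DifferOnlyAt : ∀ {h} → Word h → Word h → Fin h → Set
DifferOnlyAt a b j = lookup a j ≢ lookup b j × (∀ i → i ≢ j → lookup a i ≡ lookup b i)

differOnlyAt-unique : ∀ {h} {a b c : Word h} {j} → DifferOnlyAt a b j → DifferOnlyAt a c j → b ≡ c
differOnlyAt-unique {b = b} {c} {j} (a≢b , a≡b) (a≢c , a≡c) = lookup-extensionality bit
  where
  bit : ∀ i → lookup b i ≡ lookup c i
  bit i with i ≟ j
  ... | yes refl = trans (¬-not (a≢b ∘ sym)) (sym (¬-not (a≢c ∘ sym)))
  ... | no  i≢j  = trans (sym (a≡b i i≢j)) (a≡c i i≢j)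

differOnlyAt-head : ∀ {h x y} {a b : Word h} → x ≢ y → a ≡ b → DifferOnlyAt (x ∷ a) (y ∷ b) zero
differOnlyAt-head x≢y refl = x≢y , λ { zero 0≢0 → contradiction refl 0≢0 ; (suc i) _ → refl }

differOnlyAt-cons : ∀ {h x} {a b : Word h} {j} → DifferOnlyAt a b j → DifferOnlyAt (x ∷ a) (x ∷ b) (suc j)
differOnlyAt-cons (a≢b , a≡b) = a≢b , λ { zero _ → refl ; (suc i) i≢j → a≡b i (i≢j ∘ cong suc) }

differOnlyAt-tail : ∀ {h x y} {a b : Word h} {j} → DifferOnlyAt (x ∷ a) (y ∷ b) (suc j) → DifferOnlyAt a b j
differOnlyAt-tail (a≢b , a≡b) = a≢b , λ i i≢j → a≡b (suc i) (i≢j ∘ suc-injective)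

hamming-self : ∀ {h} (a : Word h) → hamming a a ≡ 0
hamming-self []          = refl
hamming-self (true ∷ a)  = hamming-self a
hamming-self (false ∷ a) = hamming-self a

hamming≡0⇒≡ : ∀ {h} (a b : Word h) → hamming a b ≡ 0 → a ≡ b
hamming≡0⇒≡ []          []          _  = refl
hamming≡0⇒≡ (true ∷ a)  (true ∷ b)  eq = cong (true ∷_) (hamming≡0⇒≡ a b eq)
hamming≡0⇒≡ (false ∷ a) (false ∷ b) eq = cong (false ∷_) (hamming≡0⇒≡ a b eq)

hamming≡1⇒differOnlyAt : ∀ {h} (a b : Word h) → hamming a b ≡ 1 → ∃ (DifferOnlyAt a b)
hamming≡1⇒differOnlyAt [] [] ()
hamming≡1⇒differOnlyAt (true ∷ a) (true ∷ b) eq =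
  let j , d = hamming≡1⇒differOnlyAt a b eq in suc j , differOnlyAt-cons d
hamming≡1⇒differOnlyAt (false ∷ a) (false ∷ b) eq =
  let j , d = hamming≡1⇒differOnlyAt a b eq in suc j , differOnlyAt-cons d
hamming≡1⇒differOnlyAt (true ∷ a) (false ∷ b) eq =
  zero , differOnlyAt-head (λ ()) (hamming≡0⇒≡ a b (ℕ.suc-injective eq))
hamming≡1⇒differOnlyAt (false ∷ a) (true ∷ b) eq =
  zero , differOnlyAt-head (λ ()) (hamming≡0⇒≡ a b (ℕ.suc-injective eq))

hamming≡sum : ∀ {h} (a b : Word h) →
              hamming a b ≡ sum (λ i → if lookup a i xor lookup b i then 1 else 0)
hamming≡sum []          []          = refl
hamming≡sum (true ∷ a)  (true ∷ b)  = hamming≡sum a b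
hamming≡sum (true ∷ a)  (false ∷ b) = cong suc (hamming≡sum a b)
hamming≡sum (false ∷ a) (true ∷ b)  = cong suc (hamming≡sum a b)
hamming≡sum (false ∷ a) (false ∷ b) = hamming≡sum a b

weight : ∀ {h} → Word h → ℕ
weight a = hamming (zeroWord _) a

weight-differOnlyAt : ∀ {h} {a b : Word h} {j} → DifferOnlyAt a b j → lookup a j ≡ false →
                      weight b ≡ suc (weight a)
weight-differOnlyAt {a = true ∷ a}  {_}         {zero}  _          ()
weight-differOnlyAt {a = false ∷ a} {false ∷ b} {zero}  (a≢b , _)  _ = contradiction refl a≢b
weight-differOnlyAt {a = false ∷ a} {true ∷ b}  {zero}  (_ , a≡b)  _ =
  cong (suc ∘ weight) (sym (lookup-extensionality (λ i → a≡b (suc i) (λ ()))))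
weight-differOnlyAt {a = true ∷ a}  {true ∷ b}  {suc j} d aj =
  cong suc (weight-differOnlyAt (differOnlyAt-tail d) aj)
weight-differOnlyAt {a = false ∷ a} {false ∷ b} {suc j} d aj = weight-differOnlyAt (differOnlyAt-tail d) aj
weight-differOnlyAt {a = true ∷ a}  {false ∷ b} {suc j} (_ , a≡b) _ = contradiction (a≡b zero (λ ())) (λ ())
weight-differOnlyAt {a = false ∷ a} {true ∷ b}  {suc j} (_ , a≡b) _ = contradiction (a≡b zero (λ ())) (λ ())

≢⇒xor≡true : ∀ {x y} → x ≢ y → x xor y ≡ true
≢⇒xor≡true {y = y} x≢y = trans (cong (_xor y) (¬-not x≢y)) (xor-inverseˡ y)

xor-cancelʳ : ∀ x y z → (x xor z) xor (y xor z) ≡ x xor y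
xor-cancelʳ true  true  true  = refl
xor-cancelʳ true  true  false = refl
xor-cancelʳ true  false true  = refl
xor-cancelʳ true  false false = refl
xor-cancelʳ false true  true  = refl
xor-cancelʳ false true  false = refl
xor-cancelʳ false false true  = refl
xor-cancelʳ false false false = refl

cubeMap : ∀ {h} → Permutation h h → Word h → Word h → Word h
cubeMap π c a = tabulate (λ i → lookup a (π ⟨$⟩ʳ i) xor lookup c (π ⟨$⟩ʳ i))

lookup-cubeMap : ∀ {h} (π : Permutation h h) c a i →
                 lookup (cubeMap π c a) i ≡ lookup a (π ⟨$⟩ʳ i) xor lookup c (π ⟨$⟩ʳ i)
lookup-cubeMap π c a = lookup∘tabulate _

hamming-cubeMap : ∀ {h} (π : Permutation h h) c a b → hamming (cubeMap π c a) (cubeMap π c b) ≡ hamming a b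
hamming-cubeMap π c a b = begin
  hamming (cubeMap π c a) (cubeMap π c b)
    ≡⟨ hamming≡sum (cubeMap π c a) (cubeMap π c b) ⟩
  sum (λ i → indicator (lookup (cubeMap π c a) i xor lookup (cubeMap π c b) i))
    ≡⟨ sum-cong-≗ (λ i → cong indicator (translation-invariant i)) ⟩
  sum (λ i → indicator (lookup a (π ⟨$⟩ʳ i) xor lookup b (π ⟨$⟩ʳ i)))
    ≡⟨ sum-permute (λ j → indicator (lookup a j xor lookup b j)) π ⟨
  sum (λ j → indicator (lookup a j xor lookup b j))
    ≡⟨ hamming≡sum a b ⟨
  hamming a b ∎
  where
  open ≡-Reasoning
  indicator : Bool → ℕ
  indicator x = if x then 1 else 0
  translation-invariant : ∀ i → lookup (cubeMap π c a) i xor lookup (cubeMap π c b) i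
                              ≡ lookup a (π ⟨$⟩ʳ i) xor lookup b (π ⟨$⟩ʳ i)
  translation-invariant i = trans (cong₂ _xor_ (lookup-cubeMap π c a i) (lookup-cubeMap π c b i))
                                  (xor-cancelʳ (lookup a (π ⟨$⟩ʳ i)) (lookup b (π ⟨$⟩ʳ i)) (lookup c (π ⟨$⟩ʳ i)))

cubeMap-self : ∀ {h} (π : Permutation h h) c → cubeMap π c c ≡ zeroWord h
cubeMap-self π c = lookup-extensionality λ i →
  trans (lookup-cubeMap π c c i) (trans (xor-same (lookup c (π ⟨$⟩ʳ i))) (sym (lookup-replicate i false)))

module _ (G : Graph) where

  isDist-unique : ∀ {x y k l} → IsDist G x y k → IsDist G x y l → k ≡ l
  isDist-unique (w , k-min) (w′ , l-min) = ℕ.≤-antisym (k-min _ w′) (l-min _ w)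

  isDist-zero⇒≡ : ∀ {x y} → IsDist G x y 0 → x ≡ y
  isDist-zero⇒≡ (here , _) = refl

  adjacent⇒isDist-one : ∀ {x y} → Adj G x y → IsDist G x y 1
  adjacent⇒isDist-one {x} x~y = step x~y here , shortest
    where
    shortest : ∀ m → Walk G x _ m → 1 ≤ m
    shortest zero    here = contradiction (trans (sym x~y) (irrefl G x)) λ ()
    shortest (suc m) _    = s≤s z≤n

HasTwoPredecessors : (G : Graph) → Vertex G → Vertex G → Set
HasTwoPredecessors G u v = ∃₂ λ z₁ z₂ → z₁ ≢ z₂ × InNu G u v z₁ × InNu G u v z₂

IsOrOfPredecessors : (G : Graph) (h : ℕ) → Vertex G → (Vertex G → Word h) → Vertex G → Set
IsOrOfPredecessors G h u α v = ∀ (i : Fin h) →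
  (lookup (α v) i ≡ true → ∃ λ z → InNu G u v z × lookup (α z) i ≡ true) ×
  (∀ z → InNu G u v z → lookup (α z) i ≡ true → lookup (α v) i ≡ true)

module Isometric {G : Graph} {h : ℕ} (f : Vertex G → Word h) (f-iso : IsIsometricEmbedding G h f) where

  isometric-injective : Injective _≡_ _≡_ f
  isometric-injective {x} {y} fx≡fy = isDist-zero⇒≡ G (subst (IsDist G x y) hamming≡0 (f-iso x y))
    where
    hamming≡0 : hamming (f x) (f y) ≡ 0
    hamming≡0 = trans (cong (hamming (f x)) (sym fx≡fy)) (hamming-self (f x))

  isometric-adjacent : ∀ {x y} → Adj G x y → ∃ (DifferOnlyAt (f x) (f y))
  isometric-adjacent {x} {y} x~y =
    hamming≡1⇒differOnlyAt (f x) (f y) (isDist-unique G (f-iso x y) (adjacent⇒isDist-one G x~y))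

  module _ {u : Vertex G} (f-root : f u ≡ zeroWord h) where

    isDist-weight : ∀ x → IsDist G u x (weight (f x))
    isDist-weight x = subst (λ w → IsDist G u x (hamming w (f x))) f-root (f-iso u x)

    -- Moving one step closer to u lowers the weight, so the flipped bit is set in f v.
    predecessor-bit : ∀ {v z} → InNu G u v z → ∃ λ j → lookup (f v) j ≡ true × DifferOnlyAt (f v) (f z) j
    predecessor-bit {v} {z} (v~z , k , dv , dz) =
      let j , differ = isometric-adjacent v~z in j , ¬-not (bit-set differ) , differ
      where
      bit-set : ∀ {j} → DifferOnlyAt (f v) (f z) j → lookup (f v) j ≢ false
      bit-set differ fvj≡false = <⇒≢ (s≤s (n≤1+n k)) (begin
        k                       ≡⟨ isDist-unique G dz (isDist-weight z) ⟩
        weight (f z)            ≡⟨ weight-differOnlyAt differ fvj≡false ⟩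
        suc (weight (f v))      ≡⟨ cong suc (isDist-unique G (isDist-weight v) dv) ⟩
        suc (suc k)             ∎)
        where open ≡-Reasoning

    predecessor-bit-inherited : ∀ {v z i} → InNu G u v z → lookup (f z) i ≡ true → lookup (f v) i ≡ true
    predecessor-bit-inherited {i = i} z∈ fzi with predecessor-bit z∈
    ... | j , fvj , _ , agree with i ≟ j
    ... | yes refl = fvj
    ... | no  i≢j  = trans (agree i i≢j) fzi

    -- Two predecessors flip different bits, since f is injective; one of them keeps bit i.
    predecessor-with-bit : ∀ {v i} → HasTwoPredecessors G u v → lookup (f v) i ≡ true →
                           ∃ λ z → InNu G u v z × lookup (f z) i ≡ true
    predecessor-with-bit {v} {i} (z₁ , z₂ , z₁≢z₂ , z₁∈ , z₂∈) fvi =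
      choose (proj₂ (proj₂ (predecessor-bit z₁∈))) (proj₂ (proj₂ (predecessor-bit z₂∈)))
      where
      choose : ∀ {j₁ j₂} → DifferOnlyAt (f v) (f z₁) j₁ → DifferOnlyAt (f v) (f z₂) j₂ →
               ∃ λ z → InNu G u v z × lookup (f z) i ≡ true
      choose {j₁} {j₂} d₁ d₂ with i ≟ j₁ | i ≟ j₂
      ... | no i≢j₁  | _        = z₁ , z₁∈ , trans (sym (proj₂ d₁ i i≢j₁)) fvi
      ... | yes _    | no i≢j₂  = z₂ , z₂∈ , trans (sym (proj₂ d₂ i i≢j₂)) fvi
      ... | yes refl | yes refl =
        contradiction (isometric-injective (differOnlyAt-unique {a = f v} d₁ d₂)) z₁≢z₂

    isOrOfPredecessors : ∀ {v} → HasTwoPredecessors G u v → IsOrOfPredecessors G h u f v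
    isOrOfPredecessors two i = predecessor-with-bit two , λ _ → predecessor-bit-inherited

isOrOfPredecessors-unique : ∀ {G h u α α′ v} →
                            IsOrOfPredecessors G h u α v → IsOrOfPredecessors G h u α′ v →
                            (∀ {z} → InNu G u v z → α′ z ≡ α z) → α′ v ≡ α v
isOrOfPredecessors-unique or or′ agree = lookup-extensionality λ i →
  ⇔→≡ (mk⇔ (λ α′vi → let z , z∈ , α′zi = proj₁ (or′ i) α′vi
                      in proj₂ (or i) z z∈ (trans (cong (λ w → lookup w i) (sym (agree z∈))) α′zi))
           (λ αvi → let z , z∈ , αzi = proj₁ (or i) αvi
                     in proj₂ (or′ i) z z∈ (trans (cong (λ w → lookup w i) (agree z∈)) αzi)))

isAlpha-unique : ∀ {G h u β α α′} → IsAlpha G h u β α → IsAlpha G h u β α′ →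
                 ∀ {v k} → IsDist G u v k → α′ v ≡ α v
isAlpha-unique {G} {u = u} {α = α} {α′} (α-root , α-β , α-or) (α′-root , α′-β , α′-or) = agree
  where
  agree : ∀ {v k} → IsDist G u v k → α′ v ≡ α v
  agree {v} {zero} d with refl ← isDist-zero⇒≡ G d = trans α′-root (sym α-root)
  agree {v} {suc k} d with v ≟ u | adj G u v in u~v
  ... | yes refl | _     = trans α′-root (sym α-root)
  ... | no  _    | true  = trans (α′-β v u~v) (sym (α-β v u~v))
  ... | no  v≢u  | false = isOrOfPredecessors-unique (α-or v v≢u u~v) (α′-or v v≢u u~v) predecessor-agrees
    where
    predecessor-agrees : ∀ {z} → InNu G u v z → α′ z ≡ α z
    predecessor-agrees (_ , _ , dv , dz) with refl ← ℕ.suc-injective (isDist-unique G dv d) = agree dz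

-- Relabelling a given embedding

module Relabelling {G : Graph} {h : ℕ} {u : Vertex G} (e : Vertex G → Word h)
                   (e-iso : IsIsometricEmbedding G h e) (deg-u : deg G u ≡ h)
                   {β : Vertex G → Word h} (β-valid : ValidNeighbourLabels G h u β) where

  open Isometric e e-iso using (isometric-injective; isometric-adjacent)

  label : Labelling (adj G u) h
  label v u~v = proj₁ (proj₁ β-valid v u~v)

  label-injective : InjectiveLabelling label
  label-injective {v} {w} {u~v} {u~w} eq = proj₂ β-valid v w u~v u~w (begin
    β v                   ≡⟨ proj₂ (proj₁ β-valid v u~v) ⟩
    unitWord (label v u~v) ≡⟨ cong unitWord eq ⟩
    unitWord (label w u~w) ≡⟨ proj₂ (proj₁ β-valid w u~w) ⟨
    β w                   ∎)
    where open ≡-Reasoning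

  direction : Labelling (adj G u) h
  direction v u~v = proj₁ (isometric-adjacent u~v)

  direction-differs : ∀ v u~v → DifferOnlyAt (e u) (e v) (direction v u~v)
  direction-differs v u~v = proj₂ (isometric-adjacent u~v)

  direction-injective : InjectiveLabelling direction
  direction-injective {v} {w} {u~v} {u~w} eq = isometric-injective
    (differOnlyAt-unique {a = e u} (direction-differs v u~v)
                                   (subst (DifferOnlyAt (e u) (e w)) (sym eq) (direction-differs w u~w)))

  π : Permutation h h
  π = proj₁ (matchingPermutation deg-u label direction label-injective direction-injective)

  π-matches : ∀ v u~v → π ⟨$⟩ʳ label v u~v ≡ direction v u~v
  π-matches = proj₂ (matchingPermutation deg-u label direction label-injective direction-injective)

  α : Vertex G → Word h
  α = cubeMap π (e u) ∘ e

  α-isometric : IsIsometricEmbedding G h α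
  α-isometric x y = subst (IsDist G x y) (sym (hamming-cubeMap π (e u) (e x) (e y))) (e-iso x y)

  α-root : α u ≡ zeroWord h
  α-root = cubeMap-self π (e u)

  α-neighbour : ∀ v → Adj G u v → α v ≡ β v
  α-neighbour v u~v = trans (lookup-extensionality bit) (sym (proj₂ (proj₁ β-valid v u~v)))
    where
    k : Fin h
    k = label v u~v
    flips-at : ∀ i → lookup (e v) (π ⟨$⟩ʳ i) xor lookup (e u) (π ⟨$⟩ʳ i) ≡ isYes (k ≟ i)
    flips-at i with k ≟ i
    ... | yes refl = subst (λ j → lookup (e v) j xor lookup (e u) j ≡ true) (sym (π-matches v u~v))
                           (≢⇒xor≡true (≢-sym (proj₁ (direction-differs v u~v))))
    ... | no  k≢i  = trans (cong (lookup (e v) (π ⟨$⟩ʳ i) xor_)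
                                 (proj₂ (direction-differs v u~v) (π ⟨$⟩ʳ i) πi≢πk))
                           (xor-same (lookup (e v) (π ⟨$⟩ʳ i)))
      where
      πi≢πk : π ⟨$⟩ʳ i ≢ direction v u~v
      πi≢πk πi≡πk = k≢i (permutation-injective π (trans (π-matches v u~v) (sym πi≡πk)))
    bit : ∀ i → lookup (α v) i ≡ lookup (unitWord k) i
    bit i = trans (lookup-cubeMap π (e u) (e v) i)
                  (trans (flips-at i) (sym (lookup∘tabulate (λ j → isYes (k ≟ j)) i)))

lemma3 : (G : Graph) (h : ℕ) (u : Vertex G) →
    IsPartialCubeOfDim G h →
    deg G u ≡ h →
    (∀ v → v ≢ u → adj G u v ≡ false →
       ∃ λ z₁ → ∃ λ z₂ → z₁ ≢ z₂ × InNu G u v z₁ × InNu G u v z₂) →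
    (β : Vertex G → Word h) → ValidNeighbourLabels G h u β →
    Σ (Vertex G → Word h) λ α →
      IsAlpha G h u β α ×
      IsIsometricEmbedding G h α ×
      (∀ α′ → IsAlpha G h u β α′ → ∀ v → α′ v ≡ α v)
lemma3 G h u ((e , e-iso) , _) deg-u two β β-valid =
  α , α-isAlpha , α-isometric ,
  λ α′ α′-isAlpha v → isAlpha-unique α-isAlpha α′-isAlpha (isDist-weight α-root v)
  where
  open Relabelling e e-iso deg-u β-valid
  open Isometric α α-isometric using (isOrOfPredecessors; isDist-weight)
  α-isAlpha : IsAlpha G h u β α
  α-isAlpha = α-root , α-neighbour , λ v v≢u u≁v → isOrOfPredecessors α-root (two v v≢u u≁v)
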